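{- Let $C$ be a supersingular curve of genus $g$ over $\mathbb{F}_q$, and suppose its normalized Weil numbers over $\mathbb{F}_q$ are $\zeta_{k_1}^{t_1},\ldots,\zeta_{k_{2g}}^{t_{2g}}$, where $\zeta_k=e^{2\pi i/k}$ and $\gcd(k_j,t_j)=1$ for all $j$. Let $r$ be a positive integer. Then $C$ is maximal over $\mathbb{F}_{q^r}$ if and only if both of the following hold: (1) there exist an integer $s\ge 1$ and odd integers $b_1,\ldots,b_{2g}$ such that $k_j=2^s b_j$ for all $j$; and (2) $r$ is an odd multiple of $2^{s-1}\operatorname{lcm}(b_1,\ldots,b_{2g})$.
   Context: For a curve $C$ of genus $g$ over $\mathbb{F}_q$, its zeta function is $\exp\big(\sum_{s\ge1}\#C(\mathbb{F}_{q^s})T^s/s\big)=L(T)/((1-T)(1-qT))$ with $L(T)=\prod_{i=1}^{2g}(1-\alpha_iT)\in\mathbb{Z}[T]$, $|\alpha_i|=\sqrt q$; the normalized Weil numbers are $\alpha_i/\sqrt q$. The curve is supersingular if all normalized Weil numbers are roots of unity. It is maximal over $\mathbb{F}_q$ if $\#C(\mathbb{F}_q)=1+q+2g\sqrt q$ (equivalently, all its normalized Weil numbers over $\mathbb{F}_q$ equal $-1$). The normalized Weil numbers over $\mathbb{F}_{q^r}$ are the $r$-th powers of those over $\mathbb{F}_q$. -}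

module Defs where

open import Data.Nat using (ℕ; zero; suc; _*_; _^_; _∸_; _≤_; _≥_)
open import Data.Nat.LCM using (lcm)
open import Data.Nat.GCD using (gcd)
open import Data.Nat.Divisibility using () renaming (_∣_ to _∣ℕ_)
open import Data.Integer as ℤ using (ℤ; +_)
open import Data.Integer.Divisibility using () renaming (_∣_ to _∣ℤ_)
open import Data.Fin using (Fin)
open import Data.List using (List; foldr; map; allFin)
open import Data.Product using (Σ; ∃; _×_)
open import Relation.Binary.PropositionalEquality using (_≡_)
open import Relation.Nullary using (¬_)

-- The root of unity ζ_k^t = exp(2πi t / k), represented by its order
-- parameter k (≥ 1) and exponent t ∈ ℤ.
record RootOfUnity : Set where
  constructor ζ[_]^_
  field
    order    : ℕ
    exponent : ℤ
open RootOfUnity public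

-- Equality of complex numbers ζ_k^t = ζ_k'^t'  ⟺  t/k - t'/k' ∈ ℤ
--                                             ⟺  k k' ∣ t k' - t' k.
_≈ᵤ_ : RootOfUnity → RootOfUnity → Set
(ζ[ k ]^ t) ≈ᵤ (ζ[ k′ ]^ t′) =
  (+ (k * k′)) ∣ℤ ((t ℤ.* + k′) ℤ.- (t′ ℤ.* + k))

_^ᵤ_ : RootOfUnity → ℕ → RootOfUnity
(ζ[ k ]^ t) ^ᵤ r = ζ[ k ]^ (t ℤ.* + r)

minusOne : RootOfUnity
minusOne = ζ[ 2 ]^ (+ 1)

Odd : ℕ → Set
Odd n = ¬ (2 ∣ℕ n)

lcmFam : (n : ℕ) → (Fin n → ℕ) → ℕ
lcmFam n b = foldr lcm 1 (map b (allFin n))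

-- Normalized Weil numbers of the curve over F_q, given as a family of 2g
-- roots of unity ζ_{k_j}^{t_j}.  Over F_{q^r} they are the r-th powers.
-- Maximal over F_{q^r}  ⟺  every normalized Weil number over F_{q^r} is -1
-- (the characterization given in the context).
MaximalOver : (g : ℕ) → (Fin (2 * g) → RootOfUnity) → (r : ℕ) → Set
MaximalOver g w r = ∀ j → (w j ^ᵤ r) ≈ᵤ minusOne

module Submission where

-- A normalized Weil number ζ_k^t (gcd(k,|t|) = 1) has r-th power -1 exactly
-- when k = 2h is even and r is an odd multiple of h; call this the
-- "half-odd-multiple" condition.
--
--  * Per root: unfolding the encoding of roots of unity, (ζ_k^t)^r = -1 says
--    2k ∣ 2|t|r + k.  This forces k even, then h ∣ |t| r and hence h ∣ r by
--    coprimality, and the remaining quotient must be odd; conversely an odd t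
--    (forced by coprimality with an even k) makes 2k ∣ 2|t|r + k.
--  * Globally: write r = 2^v u with u odd.  The 2-adic decomposition is unique,
--    so every half-order h_j = k_j / 2 has 2-part exactly 2^v and odd part
--    b_j ∣ u.  Hence all k_j share the 2-part 2^(v+1) and lcm(b_j) ∣ u, which
--    is condition (1)-(2) with s = v + 1; the converse is direct.

open import Defs
open import Data.Nat using (ℕ; _*_; _^_; _∸_; _≤_; _≥_)
open import Data.Nat.GCD using (gcd)
open import Data.Integer using (ℤ; ∣_∣)
open import Data.Fin using (Fin)
open import Data.Product using (Σ; ∃; _×_)
open import Function.Bundles using (_⇔_)
open import Relation.Binary.PropositionalEquality using (_≡_)

open import Data.Nat using (zero; suc; _+_; _<_; z≤n; s≤s; NonZero)
open import Data.Nat.Properties using (*-comm; *-suc; *-assoc; *-identityˡ; *-zeroʳ; +-comm; *-cancelˡ-≡; m<m+n)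
open import Data.Nat.Divisibility
  using (_∣_; divides; ∣-trans; ∣1⇒≡1; n∣n; 1∣_; ∣m+n∣m⇒∣n; n∣m*n; m∣m*n;
         ∣m⇒∣m*n; ∣n⇒∣m*n; *-monoˡ-∣; *-cancelʳ-∣)
open import Data.Nat.Coprimality using (Coprime; gcd≡1⇒coprime; coprime-divisor)
open import Data.Nat.Primality using (euclidsLemma; prime[2])
open import Data.Nat.LCM using (lcm; m∣lcm[m,n]; n∣lcm[m,n]; lcm-least; gcd*lcm)
open import Data.Nat.Induction using (<-wellFounded)
import Data.Nat.Tactic.RingSolver as ℕ-Solver
open import Induction.WellFounded using (Acc; acc)
open import Data.Integer as ℤ using (+_; -[1+_])
open import Data.Integer.Properties using (pos-*; pos-+; ∣-i∣≡∣i∣)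
import Data.Integer.Divisibility as ℤ∣
import Data.Integer.Divisibility.Signed as ℤ∣ˢ
import Data.Integer.Tactic.RingSolver as ℤ-Solver
open import Data.List using (List; []; _∷_; foldr; map; allFin)
open import Data.List.Relation.Unary.All as All using (All; []; _∷_)
open import Data.List.Relation.Unary.All.Properties using (map⁺; map⁻)
open import Data.List.Membership.Propositional.Properties using (∈-allFin)
open import Data.Product using (_,_; proj₁; proj₂)
open import Data.Sum using (_⊎_; inj₁; inj₂; [_,_])
open import Relation.Nullary using (contradiction)
open import Relation.Binary.PropositionalEquality using (refl; sym; trans; cong; subst; subst₂)
open import Function.Bundles using (mk⇔; module Equivalence)
open Equivalence using (to; from)

parity : ∀ n → Σ ℕ λ c → n ≡ 2 * c ⊎ n ≡ suc (2 * c)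
parity zero = 0 , inj₁ refl
parity (suc n) with parity n
... | c , inj₁ n≡2c  = c , inj₂ (cong suc n≡2c)
... | c , inj₂ n≡2c+1 = suc c , inj₁ (trans (cong suc n≡2c+1) (sym (*-suc 2 c)))

-- suc (suc (2c)) = 2 (c + 1), written with the factor 2 on the right as in _∣_.
double-suc : ∀ c → suc (suc (2 * c)) ≡ suc c * 2
double-suc c = trans (sym (*-suc 2 c)) (*-comm 2 (suc c))

odd-1 : Odd 1
odd-1 2∣1 with ∣1⇒≡1 2∣1
... | ()

2∣suc⇒odd : ∀ {n} → 2 ∣ suc n → Odd n
2∣suc⇒odd {n} 2∣1+n 2∣n = odd-1 (∣m+n∣m⇒∣n (subst (2 ∣_) (+-comm 1 n) 2∣1+n) 2∣n)

odd⇒2∣suc : ∀ {n} → Odd n → 2 ∣ suc n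
odd⇒2∣suc {n} odd-n with parity n
... | c , inj₁ n≡2c    = contradiction (divides c (trans n≡2c (*-comm 2 c))) odd-n
... | c , inj₂ refl    = divides (suc c) (double-suc c)

odd-suc-double : ∀ c → Odd (suc (2 * c))
odd-suc-double c = 2∣suc⇒odd (divides (suc c) (double-suc c))

odd-* : ∀ {a b} → Odd a → Odd b → Odd (a * b)
odd-* {a} {b} odd-a odd-b 2∣ab = [ odd-a , odd-b ] (euclidsLemma a b prime[2] 2∣ab)

odd-*ˡ : ∀ {a b} → Odd (a * b) → Odd a
odd-*ˡ {a} {b} odd-ab 2∣a = odd-ab (∣m⇒∣m*n b 2∣a)

odd-*ʳ : ∀ {a b} → Odd (a * b) → Odd b
odd-*ʳ {a} {b} odd-ab 2∣b = odd-ab (∣n⇒∣m*n a 2∣b)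

TwoAdicForm : ℕ → Set
TwoAdicForm n = Σ ℕ λ v → Σ ℕ λ u → Odd u × n ≡ 2 ^ v * u

twoAdic-exists : ∀ n → 1 ≤ n → TwoAdicForm n
twoAdic-exists n = halve n (<-wellFounded n)
  where
  halve : ∀ n → Acc _<_ n → 1 ≤ n → TwoAdicForm n
  halve n (acc smaller) n≥1 with parity n
  ... | c , inj₂ refl = 0 , suc (2 * c) , odd-suc-double c , sym (*-identityˡ _)
  ... | zero , inj₁ refl = contradiction n≥1 λ ()
  ... | suc c , inj₁ refl with halve (suc c) (smaller (m<m+n (suc c) (s≤s z≤n))) (s≤s z≤n)
  ...   | v , u , odd-u , c+1≡2^v*u =
    suc v , u , odd-u , trans (cong (2 *_) c+1≡2^v*u) (sym (*-assoc 2 (2 ^ v) u))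

2∣2^suc* : ∀ v x → 2 ∣ 2 ^ suc v * x
2∣2^suc* v x = ∣m⇒∣m*n x (m∣m*n (2 ^ v))

twoAdic-unique : ∀ v w x y → Odd x → Odd y → 2 ^ v * x ≡ 2 ^ w * y → v ≡ w × x ≡ y
twoAdic-unique zero zero x y _ _ x≡y =
  refl , trans (sym (*-identityˡ x)) (trans x≡y (*-identityˡ y))
twoAdic-unique zero (suc w) x y odd-x _ x≡2y =
  contradiction (subst (2 ∣_) (trans (sym x≡2y) (*-identityˡ x)) (2∣2^suc* w y)) odd-x
twoAdic-unique (suc v) zero x y _ odd-y 2x≡y =
  contradiction (subst (2 ∣_) (trans 2x≡y (*-identityˡ y)) (2∣2^suc* v x)) odd-y
twoAdic-unique (suc v) (suc w) x y odd-x odd-y 2x≡2y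
  with twoAdic-unique v w x y odd-x odd-y (*-cancelˡ-≡ _ _ 2 halved)
  where
  halved : 2 * (2 ^ v * x) ≡ 2 * (2 ^ w * y)
  halved = trans (sym (*-assoc 2 (2 ^ v) x)) (trans 2x≡2y (*-assoc 2 (2 ^ w) y))
... | v≡w , x≡y = cong suc v≡w , x≡y

family⇒All : ∀ {n} {b : Fin n → ℕ} {Q : ℕ → Set} → (∀ j → Q (b j)) → All Q (map b (allFin n))
family⇒All Q-b = map⁺ (All.tabulate (λ {j} _ → Q-b j))

All⇒family : ∀ {n} {b : Fin n → ℕ} {Q : ℕ → Set} → All Q (map b (allFin n)) → ∀ j → Q (b j)
All⇒family Q-bs j = All.lookup (map⁻ Q-bs) (∈-allFin j)

lcmList : List ℕ → ℕ
lcmList = foldr lcm 1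

lcmList-common : ∀ xs → All (_∣ lcmList xs) xs
lcmList-common [] = []
lcmList-common (x ∷ xs) =
  m∣lcm[m,n] x (lcmList xs) ∷ All.map (λ y∣l → ∣-trans y∣l (n∣lcm[m,n] x (lcmList xs))) (lcmList-common xs)

lcmList-least : ∀ {u} xs → All (_∣ u) xs → lcmList xs ∣ u
lcmList-least [] [] = 1∣ _
lcmList-least (x ∷ xs) (x∣u ∷ xs∣u) = lcm-least x∣u (lcmList-least xs xs∣u)

-- ... and odd when all entries are odd, since lcm x y ∣ x * y.
lcmList-odd : ∀ xs → All Odd xs → Odd (lcmList xs)
lcmList-odd [] [] = odd-1
lcmList-odd (x ∷ xs) (odd-x ∷ odd-xs) 2∣lcm =
  odd-* odd-x (lcmList-odd xs odd-xs)
    (∣-trans 2∣lcm (divides (gcd x (lcmList xs)) (sym (gcd*lcm x (lcmList xs)))))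

lcmFam-common : ∀ n (b : Fin n → ℕ) j → b j ∣ lcmFam n b
lcmFam-common n b = All⇒family (lcmList-common (map b (allFin n)))

lcmFam-least : ∀ n (b : Fin n → ℕ) {u} → (∀ j → b j ∣ u) → lcmFam n b ∣ u
lcmFam-least n b b∣u = lcmList-least (map b (allFin n)) (family⇒All b∣u)

lcmFam-odd : ∀ n (b : Fin n → ℕ) → (∀ j → Odd (b j)) → Odd (lcmFam n b)
lcmFam-odd n b odd-b = lcmList-odd (map b (allFin n)) (family⇒All odd-b)

∣⇔∣+self : ∀ D X → D ℤ∣.∣ X ⇔ D ℤ∣.∣ X ℤ.+ D
∣⇔∣+self D X = mk⇔
  (λ D∣X → ℤ∣ˢ.∣⇒∣ᵤ (ℤ∣ˢ.∣m∣n⇒∣m+n {D} {X} {D} (ℤ∣ˢ.∣ᵤ⇒∣ D∣X) (ℤ∣ˢ.∣-refl {D})))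
  (λ D∣X+D → ℤ∣ˢ.∣⇒∣ᵤ (ℤ∣ˢ.∣m+n∣n⇒∣m {D} {X} {D} (ℤ∣ˢ.∣ᵤ⇒∣ D∣X+D) (ℤ∣ˢ.∣-refl {D})))

cast-2ar+k : ∀ a r k → + (a * r * 2 + k) ≡ + a ℤ.* + r ℤ.* + 2 ℤ.+ + k
cast-2ar+k a r k =
  trans (pos-+ (a * r * 2) k)
        (cong (ℤ._+ + k) (trans (pos-* (a * r) 2) (cong (ℤ._* + 2) (pos-* a r))))

-- (ζ_k^t)^r = -1 unfolds to 2k ∣ 2tr - k.  For t = a ≥ 0 this differs from
-- 2ar + k by 2k; for t < 0 it is the negative of 2|t|r + k.
powerIsMinusOne⇔ : ∀ k t r → ((ζ[ k ]^ t) ^ᵤ r) ≈ᵤ minusOne ⇔ k * 2 ∣ ∣ t ∣ * r * 2 + k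
powerIsMinusOne⇔ k (+ a) r =
  subst (λ Y → (+ (k * 2) ℤ∣.∣ X) ⇔ (+ (k * 2) ℤ∣.∣ Y)) X+2k≡2ar+k (∣⇔∣+self (+ (k * 2)) X)
  where
  X : ℤ
  X = (+ a ℤ.* + r) ℤ.* + 2 ℤ.- (+ 1 ℤ.* + k)
  shift : ∀ A K → A ℤ.* + 2 ℤ.- (+ 1 ℤ.* K) ℤ.+ K ℤ.* + 2 ≡ A ℤ.* + 2 ℤ.+ K
  shift = ℤ-Solver.solve-∀
  X+2k≡2ar+k : X ℤ.+ + (k * 2) ≡ + (a * r * 2 + k)
  X+2k≡2ar+k = trans (cong (λ D → X ℤ.+ D) (pos-* k 2))
                     (trans (shift (+ a ℤ.* + r) (+ k)) (sym (cast-2ar+k a r k)))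
powerIsMinusOne⇔ k -[1+ n ] r =
  mk⇔ (subst (k * 2 ∣_) ∣X∣≡2ar+k) (subst (k * 2 ∣_) (sym ∣X∣≡2ar+k))
  where
  negate : ∀ A R K → (ℤ.- A) ℤ.* R ℤ.* + 2 ℤ.- (+ 1 ℤ.* K) ≡ ℤ.- (A ℤ.* R ℤ.* + 2 ℤ.+ K)
  negate = ℤ-Solver.solve-∀
  ∣X∣≡2ar+k : ∣ (-[1+ n ] ℤ.* + r) ℤ.* + 2 ℤ.- (+ 1 ℤ.* + k) ∣ ≡ suc n * r * 2 + k
  ∣X∣≡2ar+k = trans (cong ∣_∣ (negate (+ suc n) (+ r) (+ k)))
                    (trans (∣-i∣≡∣i∣ (+ suc n ℤ.* + r ℤ.* + 2 ℤ.+ + k)) (cong ∣_∣ (sym (cast-2ar+k (suc n) r k))))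

HalfOddMultiple : ℕ → ℕ → Set
HalfOddMultiple k r = Σ ℕ λ h → k ≡ 2 * h × Σ ℕ λ m → Odd m × r ≡ m * h

even-order : ∀ k a r → k * 2 ∣ a * r * 2 + k → 2 ∣ k
even-order k a r 2k∣2ar+k = ∣m+n∣m⇒∣n (∣-trans (n∣m*n k) 2k∣2ar+k) (n∣m*n (a * r))

odd-cofactor : ∀ h a m .{{_ : NonZero h}} → h * 2 ∣ h + a * (m * h) → Odd m
odd-cofactor h a m 2h∣h+amh =
  odd-*ʳ {a} (2∣suc⇒odd (*-cancelʳ-∣ h (subst₂ _∣_ (*-comm h 2) h+amh≡[1+am]h 2h∣h+amh)))
  where
  h+amh≡[1+am]h : h + a * (m * h) ≡ suc (a * m) * h
  h+amh≡[1+am]h = cong (λ x → h + x) (sym (*-assoc a m h))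

-- For an even order 2h coprime to a, 4h ∣ 2ar + 2h makes r an odd multiple of h:
-- h ∣ ar, so h ∣ r, and the cofactor is odd.
oddMultiple-of-half : ∀ h a r .{{_ : NonZero h}} → Coprime h a →
  h * 2 * 2 ∣ a * r * 2 + h * 2 → Σ ℕ λ m → Odd m × r ≡ m * h
oddMultiple-of-half h a r coprime 4h∣2ar+2h = cofactor (coprime-divisor coprime h∣ar)
  where
  regroup : ∀ a r h → a * r * 2 + h * 2 ≡ (h + a * r) * 2
  regroup = ℕ-Solver.solve-∀
  2h∣h+ar : h * 2 ∣ h + a * r
  2h∣h+ar = *-cancelʳ-∣ 2 (subst (h * 2 * 2 ∣_) (regroup a r h) 4h∣2ar+2h)
  h∣ar : h ∣ a * r
  h∣ar = ∣m+n∣m⇒∣n (∣-trans (m∣m*n 2) 2h∣h+ar) n∣n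
  cofactor : h ∣ r → Σ ℕ λ m → Odd m × r ≡ m * h
  cofactor (divides m r≡mh) =
    m , odd-cofactor h a m (subst (λ x → h * 2 ∣ h + a * x) r≡mh 2h∣h+ar) , r≡mh

maximal⇒halfOddMultiple : ∀ k a r → 1 ≤ k → gcd k a ≡ 1 →
  k * 2 ∣ a * r * 2 + k → HalfOddMultiple k r
maximal⇒halfOddMultiple k a r k≥1 gcd≡1 2k∣2ar+k with even-order k a r 2k∣2ar+k
... | divides zero refl = contradiction k≥1 λ ()
... | divides h@(suc _) refl =
  h , *-comm h 2 , oddMultiple-of-half h a r coprime-h 2k∣2ar+k
  where
  coprime-h : Coprime h a
  coprime-h (d∣h , d∣a) = gcd≡1⇒coprime gcd≡1 (∣-trans d∣h (m∣m*n 2) , d∣a)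

-- Backward direction: a is odd (coprime to the even k), so 2 ∣ 1 + am and
-- 2·2h ∣ (1 + am)·2h = 2a(mh) + 2h.
halfOddMultiple⇒maximal : ∀ k a r → gcd k a ≡ 1 → HalfOddMultiple k r → k * 2 ∣ a * r * 2 + k
halfOddMultiple⇒maximal .(2 * h) a .(m * h) gcd≡1 (h , refl , m , odd-m , refl) =
  subst₂ _∣_ (*-comm 2 (2 * h)) (expand a m h) (*-monoˡ-∣ (2 * h) (odd⇒2∣suc (odd-* odd-a odd-m)))
  where
  odd-a : Odd a
  odd-a 2∣a with gcd≡1⇒coprime gcd≡1 (m∣m*n h , 2∣a)
  ... | ()
  expand : ∀ a m h → suc (a * m) * (2 * h) ≡ a * (m * h) * 2 + 2 * h
  expand = ℕ-Solver.solve-∀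

powerIsMinusOne⇔halfOddMultiple : ∀ k t r → 1 ≤ k → gcd k ∣ t ∣ ≡ 1 →
  ((ζ[ k ]^ t) ^ᵤ r) ≈ᵤ minusOne ⇔ HalfOddMultiple k r
powerIsMinusOne⇔halfOddMultiple k t r k≥1 gcd≡1 = mk⇔
  (λ power≡-1 → maximal⇒halfOddMultiple k ∣ t ∣ r k≥1 gcd≡1 (to (powerIsMinusOne⇔ k t r) power≡-1))
  (λ half → from (powerIsMinusOne⇔ k t r) (halfOddMultiple⇒maximal k ∣ t ∣ r gcd≡1 half))

TwoAdicCondition : (n : ℕ) → (Fin n → ℕ) → ℕ → Set
TwoAdicCondition n k r = Σ ℕ λ s → Σ (Fin n → ℕ) λ b →
  (s ≥ 1 × (∀ j → Odd (b j)) × (∀ j → k j ≡ 2 ^ s * b j))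
  × (Σ ℕ λ m → Odd m × r ≡ m * (2 ^ (s ∸ 1) * lcmFam n b))

-- If r = 2^v u (u odd) is an odd multiple of h, then h has the same 2-part:
-- h = 2^v c with c odd and c ∣ u (uniqueness of 2-adic decompositions).
halfOrder-twoAdic : ∀ {r v u m h} → 1 ≤ r → Odd u → r ≡ 2 ^ v * u → Odd m → r ≡ m * h →
  Σ ℕ λ c → Odd c × h ≡ 2 ^ v * c × c ∣ u
halfOrder-twoAdic {m = m} {h = zero} r≥1 _ _ _ r≡m*0 =
  contradiction (subst (1 ≤_) (trans r≡m*0 (*-zeroʳ m)) r≥1) λ ()
halfOrder-twoAdic {r} {v} {u} {m} {h@(suc _)} _ odd-u r≡2^v*u odd-m r≡mh
  with twoAdic-exists h (s≤s z≤n)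
... | w , c , odd-c , h≡2^w*c
  with twoAdic-unique v w u (m * c) odd-u (odd-* odd-m odd-c)
         (trans (sym r≡2^v*u) (trans r≡mh (trans (cong (m *_) h≡2^w*c) (rotate m (2 ^ w) c))))
  where
  rotate : ∀ m p c → m * (p * c) ≡ p * (m * c)
  rotate = ℕ-Solver.solve-∀
... | refl , u≡mc = c , odd-c , h≡2^w*c , divides m u≡mc

-- If every root has the half-odd-multiple property, the orders satisfy (1)-(2)
-- with s = v + 1 where 2^v is the 2-part of r, and r = q · 2^v · lcm(b) with q odd.
allHalfOddMultiple⇒condition : ∀ n (k : Fin n → ℕ) r → 1 ≤ r →
  (∀ j → HalfOddMultiple (k j) r) → TwoAdicCondition n k r
allHalfOddMultiple⇒condition n k r r≥1 half with twoAdic-exists r r≥1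
... | v , u , odd-u , r≡2^v*u = suc v , b , (s≤s z≤n , odd-b , k≡2^s*b) , q , odd-q , r≡q*2^v*L
  where
  oddPart : ∀ j → Σ ℕ λ c → Odd c × k j ≡ 2 ^ suc v * c × c ∣ u
  oddPart j with half j
  ... | h , k≡2h , m , odd-m , r≡mh with halfOrder-twoAdic {v = v} r≥1 odd-u r≡2^v*u odd-m r≡mh
  ...   | c , odd-c , h≡2^v*c , c∣u =
    c , odd-c , trans k≡2h (trans (cong (2 *_) h≡2^v*c) (sym (*-assoc 2 (2 ^ v) c))) , c∣u
  b : Fin n → ℕ
  b j = proj₁ (oddPart j)
  odd-b : ∀ j → Odd (b j)
  odd-b j = proj₁ (proj₂ (oddPart j))
  k≡2^s*b : ∀ j → k j ≡ 2 ^ suc v * b j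
  k≡2^s*b j = proj₁ (proj₂ (proj₂ (oddPart j)))
  L : ℕ
  L = lcmFam n b
  L∣u : L ∣ u
  L∣u = lcmFam-least n b (λ j → proj₂ (proj₂ (proj₂ (oddPart j))))
  q : ℕ
  q = _∣_.quotient L∣u
  u≡qL : u ≡ q * L
  u≡qL = _∣_.equality L∣u
  odd-q : Odd q
  odd-q = odd-*ˡ (subst Odd u≡qL odd-u)
  r≡q*2^v*L : r ≡ q * (2 ^ v * L)
  r≡q*2^v*L = trans r≡2^v*u (trans (cong (2 ^ v *_) u≡qL) (rotate (2 ^ v) q L))
    where
    rotate : ∀ p q L → p * (q * L) ≡ q * (p * L)
    rotate = ℕ-Solver.solve-∀

-- Conversely, from (1)-(2): k_j = 2 (2^(s-1) b_j) and r = (m c) 2^(s-1) b_j, where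
-- lcm(b) = c b_j with c odd because the lcm of odd numbers is odd.
condition⇒allHalfOddMultiple : ∀ n (k : Fin n → ℕ) r →
  TwoAdicCondition n k r → ∀ j → HalfOddMultiple (k j) r
condition⇒allHalfOddMultiple n k r (zero , _ , (() , _) , _)
condition⇒allHalfOddMultiple n k r (suc v , b , (_ , odd-b , k≡2^s*b) , m , odd-m , r≡m*2^v*L) j
  with lcmFam-common n b j
... | divides c L≡c*b =
  2 ^ v * b j , trans (k≡2^s*b j) (*-assoc 2 (2 ^ v) (b j)) ,
  m * c , odd-* odd-m (odd-*ˡ (subst Odd L≡c*b (lcmFam-odd n b odd-b))) ,
  trans r≡m*2^v*L (trans (cong (λ L → m * (2 ^ v * L)) L≡c*b) (regroup m (2 ^ v) c (b j)))
  where
  regroup : ∀ m p c x → m * (p * (c * x)) ≡ m * c * (p * x)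
  regroup = ℕ-Solver.solve-∀

allHalfOddMultiple⇔condition : ∀ n (k : Fin n → ℕ) r → 1 ≤ r →
  (∀ j → HalfOddMultiple (k j) r) ⇔ TwoAdicCondition n k r
allHalfOddMultiple⇔condition n k r r≥1 =
  mk⇔ (allHalfOddMultiple⇒condition n k r r≥1) (condition⇒allHalfOddMultiple n k r)

mainTheorem2 : (g : ℕ) (k : Fin (2 * g) → ℕ) (t : Fin (2 * g) → ℤ)
    → (∀ j → 1 ≤ k j)
    → (∀ j → gcd (k j) ∣ t j ∣ ≡ 1)
    → (r : ℕ) → 1 ≤ r
    → MaximalOver g (λ j → ζ[ k j ]^ t j) r
      ⇔ (Σ ℕ λ s → Σ (Fin (2 * g) → ℕ) λ b →
          (s ≥ 1 × (∀ j → Odd (b j)) × (∀ j → k j ≡ 2 ^ s * b j))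
          × (Σ ℕ λ m → Odd m × r ≡ m * (2 ^ (s ∸ 1) * lcmFam (2 * g) b)))
mainTheorem2 g k t k≥1 gcd≡1 r r≥1 = mk⇔
  (λ maximal → to global (λ j → to (perRoot j) (maximal j)))
  (λ condition j → from (perRoot j) (from global condition j))
  where
  perRoot : ∀ j → ((ζ[ k j ]^ t j) ^ᵤ r) ≈ᵤ minusOne ⇔ HalfOddMultiple (k j) r
  perRoot j = powerIsMinusOne⇔halfOddMultiple (k j) (t j) r (k≥1 j) (gcd≡1 j)
  global : (∀ j → HalfOddMultiple (k j) r) ⇔ TwoAdicCondition (2 * g) k r
  global = allHalfOddMultiple⇔condition (2 * g) k r r≥1
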